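{- Assume the setting below. Then: (1) for all $\alpha\in Q(X)$, $\beta\in Q(Y)$, $\jmath_{X\multimap Y}(\iota_{X,Y}(\alpha,\beta))\le\iota_{X,Y}(\jmath_X(\alpha),\jmath_Y(\beta))$; consequently, if $\beta\in Q^{\jmath}(Y)$, then $\iota_{X,Y}(\alpha,\beta)\in Q^{\jmath}(X\multimap Y)$ for every $\alpha\in Q(X)$; (2) for every $\alpha\in Q(X)$, $\omega_X(\alpha)\in Q^{\jmath}(X^{*})$; (3) $\jmath_0(\omega)=\omega$.
   Context: $(\mathsf{C},\otimes,I,a,\lambda,\rho,\sigma)$ is $*$-autonomous (symmetric monoidal closed, internal hom $\multimap$, counit $\mathrm{ev}_{X,Y}:X\otimes(X\multimap Y)\to Y$, dualizing object $0$). $Q:\mathsf{C}\to\mathsf{SLatt}$ is a monoidal functor into complete lattices and sup-preserving maps, with $u\in Q(I)$ and $\mu_{X,Y}:Q(X)\times Q(Y)\to Q(X\otimes Y)$ sup-preserving in each variable, natural, and satisfying $Q(\lambda_Y)(\mu_{I,Y}(u,y))=y$, $Q(\rho_X)(\mu_{X,I}(x,u))=x$, $Q(a)(\mu(\mu(x,y),z))=\mu(x,\mu(y,z))$, $Q(\sigma_{X,Y})(\mu_{X,Y}(x,y))=\mu_{Y,X}(y,x)$. Put $\langle x,b\rangle_{X,Y}:=Q(\mathrm{ev}_{X,Y})(\mu_{X,X\multimap Y}(x,b))$ and let $\iota_{X,Y}(\alpha,-)$ be the right adjoint of $\langle\alpha,-\rangle_{X,Y}$. Fix $\omega\in Q(0)$;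 $X^*:=X\multimap0$, $\omega_X(\alpha):=\iota_{X,0}(\alpha,\omega)$, $\beta^\perp:=\bigvee\{\alpha\in Q(X)\mid\langle\alpha,\beta\rangle_{X,0}\le\omega\}$ for $\beta\in Q(X^*)$, $\jmath_X(\alpha):=(\omega_X(\alpha))^\perp$, and $Q^\jmath(X):=\{\alpha\in Q(X)\mid\jmath_X(\alpha)=\alpha\}$. -}

module Defs where

open import Level using (Level; _⊔_) renaming (suc to lsuc)
open import Relation.Binary.PropositionalEquality using (_≡_)
open import Relation.Binary.Structures using (IsEquivalence)
open import Data.Product using (Σ; _×_; proj₁; _,_)

record CompleteLattice (c ℓ : Level) : Set (lsuc (c ⊔ ℓ)) where
  infix 4 _≤_
  field
    Carrier : Set c
    _≤_     : Carrier → Carrier → Set ℓ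
    ≤-refl  : ∀ {x} → x ≤ x
    ≤-trans : ∀ {x y z} → x ≤ y → y ≤ z → x ≤ z
    ≤-antisym : ∀ {x y} → x ≤ y → y ≤ x → x ≡ y
    ⋁       : {J : Set (c ⊔ ℓ)} → (J → Carrier) → Carrier
    ⋁-upper : {J : Set (c ⊔ ℓ)} (f : J → Carrier) (j : J) → f j ≤ ⋁ f
    ⋁-least : {J : Set (c ⊔ ℓ)} (f : J → Carrier) (z : Carrier) →
              (∀ j → f j ≤ z) → ⋁ f ≤ z

open CompleteLattice public using (Carrier)

SupPreserving : ∀ {c ℓ} (L M : CompleteLattice c ℓ) →
                (Carrier L → Carrier M) → Set (lsuc (c ⊔ ℓ))
SupPreserving {c} {ℓ} L M h =
  {J : Set (c ⊔ ℓ)} (f : J → Carrier L) →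
  h (CompleteLattice.⋁ L f) ≡ CompleteLattice.⋁ M (λ j → h (f j))

record StarAutonomous (o h e : Level) : Set (lsuc (o ⊔ h ⊔ e)) where
  infix  4 _≈_
  infixr 9 _∘_
  infixr 10 _⊗₀_ _⊗₁_
  infixr 5 _⊸_
  infix  3 _⇒_
  field
    Obj : Set o
    _⇒_ : Obj → Obj → Set h
    _≈_ : ∀ {A B} → A ⇒ B → A ⇒ B → Set e
    id  : ∀ {A} → A ⇒ A
    _∘_ : ∀ {A B C} → B ⇒ C → A ⇒ B → A ⇒ C
    ≈-equiv   : ∀ {A B} → IsEquivalence (_≈_ {A} {B})
    ∘-resp-≈  : ∀ {A B C} {f f' : B ⇒ C} {g g' : A ⇒ B} →
                f ≈ f' → g ≈ g' → f ∘ g ≈ f' ∘ g'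
    identityˡ : ∀ {A B} {f : A ⇒ B} → id ∘ f ≈ f
    identityʳ : ∀ {A B} {f : A ⇒ B} → f ∘ id ≈ f
    assoc     : ∀ {A B C D} {f : A ⇒ B} {g : B ⇒ C} {k : C ⇒ D} →
                (k ∘ g) ∘ f ≈ k ∘ (g ∘ f)

    _⊗₀_ : Obj → Obj → Obj
    _⊗₁_ : ∀ {A B C D} → A ⇒ B → C ⇒ D → A ⊗₀ C ⇒ B ⊗₀ D
    ⊗-id  : ∀ {A C} → id {A} ⊗₁ id {C} ≈ id
    ⊗-∘   : ∀ {A B C D E F} {f : A ⇒ B} {g : B ⇒ C} {k : D ⇒ E} {l : E ⇒ F} →
            (g ∘ f) ⊗₁ (l ∘ k) ≈ (g ⊗₁ l) ∘ (f ⊗₁ k)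
    ⊗-resp-≈ : ∀ {A B C D} {f f' : A ⇒ B} {g g' : C ⇒ D} →
               f ≈ f' → g ≈ g' → f ⊗₁ g ≈ f' ⊗₁ g'

    I    : Obj
    a    : ∀ {X Y Z} → (X ⊗₀ Y) ⊗₀ Z ⇒ X ⊗₀ (Y ⊗₀ Z)
    a⁻¹  : ∀ {X Y Z} → X ⊗₀ (Y ⊗₀ Z) ⇒ (X ⊗₀ Y) ⊗₀ Z
    λ'   : ∀ {X} → I ⊗₀ X ⇒ X
    λ'⁻¹ : ∀ {X} → X ⇒ I ⊗₀ X
    ρ    : ∀ {X} → X ⊗₀ I ⇒ X
    ρ⁻¹  : ∀ {X} → X ⇒ X ⊗₀ I
    σ    : ∀ {X Y} → X ⊗₀ Y ⇒ Y ⊗₀ X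

    a-iso₁ : ∀ {X Y Z} → a⁻¹ {X} {Y} {Z} ∘ a ≈ id
    a-iso₂ : ∀ {X Y Z} → a {X} {Y} {Z} ∘ a⁻¹ ≈ id
    λ-iso₁ : ∀ {X} → λ'⁻¹ {X} ∘ λ' ≈ id
    λ-iso₂ : ∀ {X} → λ' {X} ∘ λ'⁻¹ ≈ id
    ρ-iso₁ : ∀ {X} → ρ⁻¹ {X} ∘ ρ ≈ id
    ρ-iso₂ : ∀ {X} → ρ {X} ∘ ρ⁻¹ ≈ id
    σ-invol : ∀ {X Y} → σ {Y} {X} ∘ σ {X} {Y} ≈ id

    a-natural : ∀ {X X' Y Y' Z Z'} {f : X ⇒ X'} {g : Y ⇒ Y'} {k : Z ⇒ Z'} →
                a ∘ ((f ⊗₁ g) ⊗₁ k) ≈ (f ⊗₁ (g ⊗₁ k)) ∘ a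
    λ-natural : ∀ {X Y} {f : X ⇒ Y} → λ' ∘ (id ⊗₁ f) ≈ f ∘ λ'
    ρ-natural : ∀ {X Y} {f : X ⇒ Y} → ρ ∘ (f ⊗₁ id) ≈ f ∘ ρ
    σ-natural : ∀ {X X' Y Y'} {f : X ⇒ X'} {g : Y ⇒ Y'} →
                σ ∘ (f ⊗₁ g) ≈ (g ⊗₁ f) ∘ σ

    triangle : ∀ {X Y} → (id ⊗₁ λ') ∘ a {X} {I} {Y} ≈ ρ ⊗₁ id
    pentagon : ∀ {W X Y Z} →
               (id ⊗₁ a) ∘ a ∘ (a ⊗₁ id) ≈ a {W} {X} {Y ⊗₀ Z} ∘ a {W ⊗₀ X} {Y} {Z}
    hexagon  : ∀ {X Y Z} →
               (id ⊗₁ σ) ∘ a ∘ (σ ⊗₁ id) ≈ a {Y} {Z} {X} ∘ σ {X} {Y ⊗₀ Z} ∘ a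

    _⊸_   : Obj → Obj → Obj
    ev    : ∀ {X Y} → X ⊗₀ (X ⊸ Y) ⇒ Y
    curry : ∀ {X Y Z} → X ⊗₀ Z ⇒ Y → Z ⇒ X ⊸ Y
    ev-curry : ∀ {X Y Z} {f : X ⊗₀ Z ⇒ Y} → ev ∘ (id ⊗₁ curry f) ≈ f
    curry-unique : ∀ {X Y Z} {f : X ⊗₀ Z ⇒ Y} {g : Z ⇒ X ⊸ Y} →
                   ev ∘ (id ⊗₁ g) ≈ f → g ≈ curry f

    𝟘   : Obj
    dd⁻¹ : ∀ {X} → (X ⊸ 𝟘) ⊸ 𝟘 ⇒ X
    dd-iso₁ : ∀ {X} → dd⁻¹ ∘ curry (ev {X} {𝟘} ∘ σ {X ⊸ 𝟘} {X}) ≈ id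
    dd-iso₂ : ∀ {X} → curry (ev {X} {𝟘} ∘ σ {X ⊸ 𝟘} {X}) ∘ dd⁻¹ ≈ id

record MonoidalSLattFunctor {o h e} (C : StarAutonomous o h e) (c ℓ : Level)
       : Set (o ⊔ h ⊔ e ⊔ lsuc (c ⊔ ℓ)) where
  open StarAutonomous C
  field
    Q₀ : Obj → CompleteLattice c ℓ
    Q₁ : ∀ {X Y} → X ⇒ Y → Carrier (Q₀ (X)) → Carrier (Q₀ (Y))
    Q₁-sup  : ∀ {X Y} (f : X ⇒ Y) → SupPreserving (Q₀ X) (Q₀ Y) (Q₁ f)
    Q₁-id   : ∀ {X} (x : Carrier (Q₀ (X))) → Q₁ id x ≡ x
    Q₁-∘    : ∀ {X Y Z} (g : Y ⇒ Z) (f : X ⇒ Y) (x : Carrier (Q₀ (X))) →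
              Q₁ (g ∘ f) x ≡ Q₁ g (Q₁ f x)
    Q₁-resp : ∀ {X Y} {f g : X ⇒ Y} → f ≈ g → (x : Carrier (Q₀ (X))) → Q₁ f x ≡ Q₁ g x

    u  : Carrier (Q₀ (I))
    μ  : ∀ {X Y} → Carrier (Q₀ (X)) → Carrier (Q₀ (Y)) → Carrier (Q₀ (X ⊗₀ Y))
    μ-supˡ : ∀ {X Y} (y : Carrier (Q₀ (Y))) → SupPreserving (Q₀ X) (Q₀ (X ⊗₀ Y)) (λ x → μ x y)
    μ-supʳ : ∀ {X Y} (x : Carrier (Q₀ (X))) → SupPreserving (Q₀ Y) (Q₀ (X ⊗₀ Y)) (λ y → μ x y)
    μ-natural : ∀ {X X' Y Y'} (f : X ⇒ X') (g : Y ⇒ Y') (x : Carrier (Q₀ (X))) (y : Carrier (Q₀ (Y))) →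
                Q₁ (f ⊗₁ g) (μ x y) ≡ μ (Q₁ f x) (Q₁ g y)
    μ-unitˡ : ∀ {Y} (y : Carrier (Q₀ (Y))) → Q₁ λ' (μ u y) ≡ y
    μ-unitʳ : ∀ {X} (x : Carrier (Q₀ (X))) → Q₁ ρ (μ x u) ≡ x
    μ-assoc : ∀ {X Y Z} (x : Carrier (Q₀ (X))) (y : Carrier (Q₀ (Y))) (z : Carrier (Q₀ (Z))) →
              Q₁ a (μ (μ x y) z) ≡ μ x (μ y z)
    μ-sym   : ∀ {X Y} (x : Carrier (Q₀ (X))) (y : Carrier (Q₀ (Y))) → Q₁ σ (μ x y) ≡ μ y x

module Nucleus {o h e c ℓ} (C : StarAutonomous o h e)
               (Q : MonoidalSLattFunctor C c ℓ) where
  open StarAutonomous C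
  open MonoidalSLattFunctor Q

  ∣_∣ : Obj → Set c
  ∣ X ∣ = Carrier (Q₀ X)

  ≤⟨_⟩ : (X : Obj) → ∣ X ∣ → ∣ X ∣ → Set ℓ
  ≤⟨ X ⟩ = CompleteLattice._≤_ (Q₀ X)

  ⋁⟨_⟩ : (X : Obj) {J : Set (c ⊔ ℓ)} → (J → ∣ X ∣) → ∣ X ∣
  ⋁⟨ X ⟩ = CompleteLattice.⋁ (Q₀ X)

  pair : (X Y : Obj) → ∣ X ∣ → ∣ X ⊸ Y ∣ → ∣ Y ∣
  pair X Y x b = Q₁ (ev {X} {Y}) (μ x b)

  -- ι_{X,Y}(α,-): the right adjoint of ⟨α,-⟩_{X,Y}, i.e.
  -- ι(α,γ) = ⋁ { b | ⟨α,b⟩ ≤ γ }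
  ι : (X Y : Obj) → ∣ X ∣ → ∣ Y ∣ → ∣ X ⊸ Y ∣
  ι X Y α γ = ⋁⟨ X ⊸ Y ⟩ {J = Σ ∣ X ⊸ Y ∣ (λ b → ≤⟨ Y ⟩ (pair X Y α b) γ)} proj₁

  _* : Obj → Obj
  X * = X ⊸ 𝟘

  module _ (ω : ∣ 𝟘 ∣) where

    ω⟨_⟩ : (X : Obj) → ∣ X ∣ → ∣ X * ∣
    ω⟨ X ⟩ α = ι X 𝟘 α ω

    perp : (X : Obj) → ∣ X * ∣ → ∣ X ∣
    perp X β = ⋁⟨ X ⟩ {J = Σ ∣ X ∣ (λ α → ≤⟨ 𝟘 ⟩ (pair X 𝟘 α β) ω)} proj₁

    ȷ : (X : Obj) → ∣ X ∣ → ∣ X ∣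
    ȷ X α = perp X (ω⟨ X ⟩ α)

    InQȷ : (X : Obj) → ∣ X ∣ → Set c
    InQȷ X α = ȷ X α ≡ α

{-# OPTIONS --safe #-}
module Submission where

-- ȷ X = perp X ∘ ω⟨ X ⟩ is the closure of a Galois connection, so it is
-- inflationary and every claim reduces to an inequality ȷ x ≤ x, i.e. to a
-- pairing landing below ω.  The key fact is that ȷ may be applied to the
-- first tensor factor of any morphism into 𝟘 without leaving the region
-- below ω: currying such a morphism exhibits it as the pairing with some
-- element of X *, and ⟨ȷ x, -⟩ is ≤ ω on everything below ω⟨ X ⟩ x.  The
-- symmetry and associativity of μ move any factor into first position.

open import Defs
open import Level using (Level)
open import Relation.Binary.PropositionalEquality
  using (_≡_; sym; trans; cong; subst; module ≡-Reasoning)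
open import Data.Product using (Σ; _×_; _,_; proj₁; proj₂)

module _ {c ℓ : Level} (L M : CompleteLattice c ℓ) where
  private
    module L = CompleteLattice L
    module M = CompleteLattice M

  SupPreserving-∘ : ∀ (N : CompleteLattice c ℓ) (g : Carrier L → Carrier M)
                    (h : Carrier M → Carrier N) →
                    SupPreserving L M g → SupPreserving M N h →
                    SupPreserving L N (λ x → h (g x))
  SupPreserving-∘ N g h g-sup h-sup f = trans (cong h (g-sup f)) (h-sup _)

  SupPreserving⇒monotone : ∀ {h : Carrier L → Carrier M} → SupPreserving L M h →
                           ∀ {x y} → x L.≤ y → h x M.≤ h y
  SupPreserving⇒monotone {h} h-sup {x} {y} x≤y =
    subst (h x M.≤_) h-down (M.⋁-upper (λ j → h (proj₁ j)) (x , x≤y))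
    where
    down : L.⋁ {J = Σ (Carrier L) (L._≤ y)} proj₁ ≡ y
    down = L.≤-antisym (L.⋁-least proj₁ y proj₂) (L.⋁-upper proj₁ (y , L.≤-refl))

    h-down : M.⋁ (λ (j : Σ (Carrier L) (L._≤ y)) → h (proj₁ j)) ≡ h y
    h-down = trans (sym (h-sup proj₁)) (cong h down)

  -- ι and perp of Defs are, definitionally, instances of this construction.
  rightAdjoint : (Carrier L → Carrier M) → Carrier M → Carrier L
  rightAdjoint h γ = L.⋁ {J = Σ (Carrier L) (λ x → h x M.≤ γ)} proj₁

  rightAdjoint-intro : ∀ (h : Carrier L → Carrier M) {x γ} →
                       h x M.≤ γ → x L.≤ rightAdjoint h γ
  rightAdjoint-intro h {x} hx≤γ = L.⋁-upper proj₁ (x , hx≤γ)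

  rightAdjoint-elim : ∀ {h : Carrier L → Carrier M} → SupPreserving L M h →
                      ∀ {x γ} → x L.≤ rightAdjoint h γ → h x M.≤ γ
  rightAdjoint-elim {h} h-sup {γ = γ} x≤r =
    M.≤-trans (SupPreserving⇒monotone h-sup x≤r)
              (subst (M._≤ γ) (sym (h-sup proj₁)) (M.⋁-least _ γ proj₂))

module Properties {o h e c ℓ : Level} (C : StarAutonomous o h e)
                  (Q : MonoidalSLattFunctor C c ℓ) where
  open StarAutonomous C
  open MonoidalSLattFunctor Q
  open Nucleus C Q
  open ≡-Reasoning

  ≤-refl : ∀ {X} {x : ∣ X ∣} → ≤⟨ X ⟩ x x
  ≤-refl {X} = CompleteLattice.≤-refl (Q₀ X)

  ≤-trans : ∀ {X} {x y z : ∣ X ∣} → ≤⟨ X ⟩ x y → ≤⟨ X ⟩ y z → ≤⟨ X ⟩ x z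
  ≤-trans {X} = CompleteLattice.≤-trans (Q₀ X)

  ≤-antisym : ∀ {X} {x y : ∣ X ∣} → ≤⟨ X ⟩ x y → ≤⟨ X ⟩ y x → x ≡ y
  ≤-antisym {X} = CompleteLattice.≤-antisym (Q₀ X)

  μ-naturalˡ : ∀ {X X' Y} (f : X ⇒ X') (x : ∣ X ∣) (y : ∣ Y ∣) →
               Q₁ (f ⊗₁ id) (μ x y) ≡ μ (Q₁ f x) y
  μ-naturalˡ f x y = trans (μ-natural f id x y) (cong (μ (Q₁ f x)) (Q₁-id y))

  μ-naturalʳ : ∀ {X Y Y'} (g : Y ⇒ Y') (x : ∣ X ∣) (y : ∣ Y ∣) →
               Q₁ (id ⊗₁ g) (μ x y) ≡ μ x (Q₁ g y)
  μ-naturalʳ g x y = trans (μ-natural id g x y) (cong (λ t → μ t (Q₁ g y)) (Q₁-id x))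

  μ-assoc⁻¹ : ∀ {X Y Z} (x : ∣ X ∣) (y : ∣ Y ∣) (z : ∣ Z ∣) →
              μ (μ x y) z ≡ Q₁ a⁻¹ (μ x (μ y z))
  μ-assoc⁻¹ x y z = begin
    μ (μ x y) z                  ≡⟨ sym (Q₁-id _) ⟩
    Q₁ id (μ (μ x y) z)          ≡⟨ sym (Q₁-resp a-iso₁ _) ⟩
    Q₁ (a⁻¹ ∘ a) (μ (μ x y) z)   ≡⟨ Q₁-∘ a⁻¹ a _ ⟩
    Q₁ a⁻¹ (Q₁ a (μ (μ x y) z))  ≡⟨ cong (Q₁ a⁻¹) (μ-assoc x y z) ⟩
    Q₁ a⁻¹ (μ x (μ y z))         ∎

  Q₁-reassoc : ∀ {A B D Z} (m : (A ⊗₀ B) ⊗₀ D ⇒ Z) p q r →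
               Q₁ m (μ (μ p q) r) ≡ Q₁ (m ∘ a⁻¹) (μ p (μ q r))
  Q₁-reassoc m p q r = trans (cong (Q₁ m) (μ-assoc⁻¹ p q r)) (sym (Q₁-∘ m a⁻¹ _))

  Q₁-swap : ∀ {A B D Z} (m : (A ⊗₀ B) ⊗₀ D ⇒ Z) p q r →
            Q₁ m (μ (μ p q) r) ≡ Q₁ (m ∘ (σ ⊗₁ id)) (μ (μ q p) r)
  Q₁-swap m p q r = begin
    Q₁ m (μ (μ p q) r)                  ≡⟨ cong (λ t → Q₁ m (μ t r)) (sym (μ-sym q p)) ⟩
    Q₁ m (μ (Q₁ σ (μ q p)) r)           ≡⟨ cong (Q₁ m) (sym (μ-naturalˡ σ (μ q p) r)) ⟩
    Q₁ m (Q₁ (σ ⊗₁ id) (μ (μ q p) r))   ≡⟨ sym (Q₁-∘ m (σ ⊗₁ id) _) ⟩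
    Q₁ (m ∘ (σ ⊗₁ id)) (μ (μ q p) r)    ∎

  pair-curry : ∀ {X Y Z} (m : X ⊗₀ Z ⇒ Y) x z →
               Q₁ m (μ x z) ≡ pair X Y x (Q₁ (curry m) z)
  pair-curry m x z = begin
    Q₁ m (μ x z)                         ≡⟨ sym (Q₁-resp ev-curry (μ x z)) ⟩
    Q₁ (ev ∘ (id ⊗₁ curry m)) (μ x z)    ≡⟨ Q₁-∘ ev (id ⊗₁ curry m) (μ x z) ⟩
    Q₁ ev (Q₁ (id ⊗₁ curry m) (μ x z))   ≡⟨ cong (Q₁ ev) (μ-naturalʳ (curry m) x z) ⟩
    Q₁ ev (μ x (Q₁ (curry m) z))         ∎

  pair-swap : ∀ {X Y} (x : ∣ X ∣) (b : ∣ X ⊸ Y ∣) → pair X Y x b ≡ Q₁ (ev ∘ σ) (μ b x)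
  pair-swap x b = trans (cong (Q₁ ev) (sym (μ-sym b x))) (sym (Q₁-∘ ev σ _))

  pair-pair : ∀ {X Y Z} (p : ∣ X ∣) (q : ∣ X ⊸ Y ∣) (r : ∣ Y ⊸ Z ∣) →
              pair Y Z (pair X Y p q) r ≡ Q₁ (ev ∘ (ev ⊗₁ id)) (μ (μ p q) r)
  pair-pair p q r = begin
    Q₁ ev (μ (Q₁ ev (μ p q)) r)          ≡⟨ cong (Q₁ ev) (sym (μ-naturalˡ ev (μ p q) r)) ⟩
    Q₁ ev (Q₁ (ev ⊗₁ id) (μ (μ p q) r))  ≡⟨ sym (Q₁-∘ ev (ev ⊗₁ id) _) ⟩
    Q₁ (ev ∘ (ev ⊗₁ id)) (μ (μ p q) r)   ∎

  pair-supˡ : ∀ X Y (b : ∣ X ⊸ Y ∣) → SupPreserving (Q₀ X) (Q₀ Y) (λ x → pair X Y x b)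
  pair-supˡ X Y b = SupPreserving-∘ (Q₀ X) (Q₀ (X ⊗₀ (X ⊸ Y))) (Q₀ Y) (λ x → μ x b) (Q₁ ev)
                                    (μ-supˡ b) (Q₁-sup ev)

  pair-supʳ : ∀ X Y (x : ∣ X ∣) → SupPreserving (Q₀ (X ⊸ Y)) (Q₀ Y) (pair X Y x)
  pair-supʳ X Y x = SupPreserving-∘ (Q₀ (X ⊸ Y)) (Q₀ (X ⊗₀ (X ⊸ Y))) (Q₀ Y) (μ x) (Q₁ ev)
                                    (μ-supʳ x) (Q₁-sup ev)

  pair-monoˡ : ∀ {X Y} {x x' : ∣ X ∣} (b : ∣ X ⊸ Y ∣) →
               ≤⟨ X ⟩ x x' → ≤⟨ Y ⟩ (pair X Y x b) (pair X Y x' b)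
  pair-monoˡ {X} {Y} b = SupPreserving⇒monotone (Q₀ X) (Q₀ Y) (pair-supˡ X Y b)

  ι-intro : ∀ {X Y} {α : ∣ X ∣} {b γ} → ≤⟨ Y ⟩ (pair X Y α b) γ → ≤⟨ X ⊸ Y ⟩ b (ι X Y α γ)
  ι-intro {X} {Y} {α} = rightAdjoint-intro (Q₀ (X ⊸ Y)) (Q₀ Y) (pair X Y α)

  ι-elim : ∀ {X Y} {α : ∣ X ∣} {b γ} → ≤⟨ X ⊸ Y ⟩ b (ι X Y α γ) → ≤⟨ Y ⟩ (pair X Y α b) γ
  ι-elim {X} {Y} {α} = rightAdjoint-elim (Q₀ (X ⊸ Y)) (Q₀ Y) (pair-supʳ X Y α)

  ι-antitoneˡ : ∀ {X Y} {α α' : ∣ X ∣} {γ : ∣ Y ∣} →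
                ≤⟨ X ⟩ α α' → ≤⟨ X ⊸ Y ⟩ (ι X Y α' γ) (ι X Y α γ)
  ι-antitoneˡ α≤α' = ι-intro (≤-trans (pair-monoˡ _ α≤α') (ι-elim ≤-refl))

  module _ (ω : ∣ 𝟘 ∣) where

    _≤ω : ∣ 𝟘 ∣ → Set ℓ
    t ≤ω = ≤⟨ 𝟘 ⟩ t ω

    perp-intro : ∀ {X} {β : ∣ X * ∣} {α} → pair X 𝟘 α β ≤ω → ≤⟨ X ⟩ α (perp ω X β)
    perp-intro {X} {β} = rightAdjoint-intro (Q₀ X) (Q₀ 𝟘) (λ α → pair X 𝟘 α β)

    perp-elim : ∀ {X} {β : ∣ X * ∣} {α} → ≤⟨ X ⟩ α (perp ω X β) → pair X 𝟘 α β ≤ω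
    perp-elim {X} {β} = rightAdjoint-elim (Q₀ X) (Q₀ 𝟘) (pair-supˡ X 𝟘 β)

    ȷ-inflationary : ∀ {X} (x : ∣ X ∣) → ≤⟨ X ⟩ x (ȷ ω X x)
    ȷ-inflationary x = perp-intro (ι-elim ≤-refl)

    ȷ-fixed : ∀ {X} {x : ∣ X ∣} → ≤⟨ X ⟩ (ȷ ω X x) x → InQȷ ω X x
    ȷ-fixed ȷx≤x = ≤-antisym ȷx≤x (ȷ-inflationary _)

    -- curry m z ≤ ω⟨ X ⟩ x ≤ ω⟨ X ⟩ (ȷ x), and ⟨ȷ x, ω⟨ X ⟩ (ȷ x)⟩ ≤ ω.
    ȷ-stable : ∀ {X Z} (m : X ⊗₀ Z ⇒ 𝟘) (x : ∣ X ∣) (z : ∣ Z ∣) →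
               Q₁ m (μ x z) ≤ω → Q₁ m (μ (ȷ ω X x) z) ≤ω
    ȷ-stable {X} m x z mxz≤ω = subst _≤ω (sym (pair-curry m (ȷ ω X x) z)) (ι-elim curry≤)
      where
      curry≤ : ≤⟨ X * ⟩ (Q₁ (curry m) z) (ω⟨_⟩ ω X (ȷ ω X x))
      curry≤ = ≤-trans (ι-intro (subst _≤ω (pair-curry m x z) mxz≤ω))
                       (ι-intro (perp-elim ≤-refl))

    ȷ-stable₁ : ∀ {A B D} (m : (A ⊗₀ B) ⊗₀ D ⇒ 𝟘) p (q : ∣ B ∣) (r : ∣ D ∣) →
                Q₁ m (μ (μ p q) r) ≤ω → Q₁ m (μ (μ (ȷ ω A p) q) r) ≤ω
    ȷ-stable₁ m p q r mpqr≤ω =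
      subst _≤ω (sym (Q₁-reassoc m _ q r))
        (ȷ-stable (m ∘ a⁻¹) p (μ q r) (subst _≤ω (Q₁-reassoc m p q r) mpqr≤ω))

    ȷ-stable₂ : ∀ {A B D} (m : (A ⊗₀ B) ⊗₀ D ⇒ 𝟘) (p : ∣ A ∣) q (r : ∣ D ∣) →
                Q₁ m (μ (μ p q) r) ≤ω → Q₁ m (μ (μ p (ȷ ω B q)) r) ≤ω
    ȷ-stable₂ m p q r mpqr≤ω =
      subst _≤ω (sym (Q₁-swap m p _ r))
        (ȷ-stable₁ (m ∘ (σ ⊗₁ id)) q p r (subst _≤ω (Q₁-swap m p q r) mpqr≤ω))

    ȷ-ι-≤ : ∀ X Y (α : ∣ X ∣) (β : ∣ Y ∣) →
            ≤⟨ X ⊸ Y ⟩ (ȷ ω (X ⊸ Y) (ι X Y α β)) (ι X Y (ȷ ω X α) (ȷ ω Y β))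
    ȷ-ι-≤ X Y α β = ι-intro (perp-intro (subst _≤ω (sym (pair-pair _ _ w)) ȷ-both))
      where
      w = ω⟨_⟩ ω Y β
      b = ι X Y α β

      ⟨⟨α,b⟩,w⟩≤ω : Q₁ (ev ∘ (ev ⊗₁ id)) (μ (μ α b) w) ≤ω
      ⟨⟨α,b⟩,w⟩≤ω = subst _≤ω (pair-pair α b w)
                            (perp-elim (≤-trans (ι-elim ≤-refl) (ȷ-inflationary β)))

      ȷ-both : Q₁ (ev ∘ (ev ⊗₁ id)) (μ (μ (ȷ ω X α) (ȷ ω (X ⊸ Y) b)) w) ≤ω
      ȷ-both = ȷ-stable₁ _ α _ w (ȷ-stable₂ _ α b w ⟨⟨α,b⟩,w⟩≤ω)

    ι-closed : ∀ X Y (α : ∣ X ∣) (β : ∣ Y ∣) → InQȷ ω Y β → InQȷ ω (X ⊸ Y) (ι X Y α β)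
    ι-closed X Y α β ȷβ≡β = ȷ-fixed (≤-trans (ȷ-ι-≤ X Y α β) ι≤)
      where
      ι≤ : ≤⟨ X ⊸ Y ⟩ (ι X Y (ȷ ω X α) (ȷ ω Y β)) (ι X Y α β)
      ι≤ = subst (λ γ → ≤⟨ X ⊸ Y ⟩ (ι X Y (ȷ ω X α) γ) (ι X Y α β)) (sym ȷβ≡β)
                 (ι-antitoneˡ (ȷ-inflationary α))

    ω⟨⟩-closed : ∀ X (α : ∣ X ∣) → InQȷ ω (X *) (ω⟨_⟩ ω X α)
    ω⟨⟩-closed X α = ȷ-fixed (ι-intro (subst _≤ω (sym (pair-swap α _)) ȷs-α))
      where
      s = ω⟨_⟩ ω X α

      ȷs-α : Q₁ (ev ∘ σ) (μ (ȷ ω (X *) s) α) ≤ω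
      ȷs-α = ȷ-stable (ev ∘ σ) s α (subst _≤ω (pair-swap α s) (ι-elim ≤-refl))

    ω-closed : InQȷ ω 𝟘 ω
    ω-closed = ȷ-fixed (subst _≤ω (μ-unitʳ _) (ȷ-stable ρ ω u ωu≤ω))
      where
      ωu≤ω : Q₁ ρ (μ ω u) ≤ω
      ωu≤ω = subst _≤ω (sym (μ-unitʳ ω)) ≤-refl

mainTheorem14 : ∀ {o h e c ℓ : Level} (C : StarAutonomous o h e)
                  (Q : MonoidalSLattFunctor C c ℓ)
                  (ω : Carrier (MonoidalSLattFunctor.Q₀ Q (StarAutonomous.𝟘 C))) →
                  let open StarAutonomous C
                      open Nucleus C Q
                  in ((∀ (X Y : Obj) (α : ∣ X ∣) (β : ∣ Y ∣) →
                        ≤⟨ X ⊸ Y ⟩ (ȷ ω (X ⊸ Y) (ι X Y α β)) (ι X Y (ȷ ω X α) (ȷ ω Y β)))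
                      × (∀ (X Y : Obj) (α : ∣ X ∣) (β : ∣ Y ∣) →
                        InQȷ ω Y β → InQȷ ω (X ⊸ Y) (ι X Y α β)))
                     × (∀ (X : Obj) (α : ∣ X ∣) → InQȷ ω (X *) (ω⟨_⟩ ω X α))
                     × (ȷ ω 𝟘 ω ≡ ω)
mainTheorem14 C Q ω = (ȷ-ι-≤ ω , ι-closed ω) , ω⟨⟩-closed ω , ω-closed ω
  where open Properties C Q
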